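{- Let $T$ be a tree with at least $3$ vertices and with no vertex of degree $2$. Then $\chi'_{CF}(T)=2$ if and only if $T$ has a maximal matching $M$ such that the subgraph of $T$ induced by $V(M)$ (the set of vertices covered by $M$) has edge set exactly $M$, i.e. $T[V(M)]=M$.
   Context: For a graph $G$ and a vertex $v$, $E_G(v)$ denotes the set of edges incident with $v$; for an edge $uv$, its closed neighbourhood is $E_G(uv)=E_G(u)\cup E_G(v)$. Given an edge-coloring of $G$, a color is a conflict-free color of an edge $e$ if it is assigned to exactly one edge of $E_G(e)$. $G$ is conflict-free $k$-edge-colorable if there is an edge-coloring using $k$ colors in which every edge has a conflict-free color. The conflict-free chromatic index $\chi'_{CF}(G)$ is the least such $k$. -}

module Defs where

open import Data.Nat using (ℕ; zero; suc; _≤_; _<_)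
open import Data.Fin using (Fin; zero; suc; inject₁; fromℕ)
open import Data.Bool using (Bool; true; false)
open import Data.List using (List; length; filterᵇ; allFin)
open import Data.Product using (Σ; ∃; _×_; _,_)
open import Data.Sum using (_⊎_)
open import Data.Empty using (⊥)
open import Relation.Nullary using (¬_)
open import Relation.Binary.PropositionalEquality using (_≡_)
open import Function.Definitions using (Injective)

record Graph : Set where
  field
    n     : ℕ
    adj   : Fin n → Fin n → Bool
    sym   : ∀ u v → adj u v ≡ adj v u
    irrefl : ∀ v → adj v v ≡ false
open Graph public

Vertex : Graph → Set
Vertex G = Fin (n G)

Adj : (G : Graph) → Vertex G → Vertex G → Set
Adj G u v = adj G u v ≡ true

degree : (G : Graph) → Vertex G → ℕ
degree G v = length (filterᵇ (adj G v) (allFin (n G)))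

data Walk (G : Graph) : Vertex G → Vertex G → Set where
  nil  : ∀ {v} → Walk G v v
  cons : ∀ {u v w} → Adj G u v → Walk G v w → Walk G u w

Connected : Graph → Set
Connected G = ∀ u v → Walk G u v

-- a cycle: distinct vertices f 0, …, f m  (m ≥ 2, i.e. at least 3 vertices)
-- with f i adjacent to f (i+1) and f m adjacent to f 0
record Cycle (G : Graph) : Set where
  field
    m      : ℕ
    len    : 2 ≤ m
    f      : Fin (suc m) → Vertex G
    inj    : Injective _≡_ _≡_ f
    step   : ∀ (i : Fin m) → Adj G (f (inject₁ i)) (f (suc i))
    close  : Adj G (f (fromℕ m)) (f zero)

Acyclic : Graph → Set
Acyclic G = ¬ Cycle G

IsTree : Graph → Set
IsTree G = Connected G × Acyclic G

-- the edge xy lies in the closed neighbourhood E_G(uv) = E_G(u) ∪ E_G(v)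
InClosedNbhd : (G : Graph) → (u v x y : Vertex G) → Set
InClosedNbhd G u v x y =
  Adj G x y × (x ≡ u ⊎ x ≡ v ⊎ y ≡ u ⊎ y ≡ v)

SameEdge : ∀ {A : Set} → A → A → A → A → Set
SameEdge x y x' y' = (x' ≡ x × y' ≡ y) ⊎ (x' ≡ y × y' ≡ x)

record EdgeColoring (G : Graph) (k : ℕ) : Set where
  field
    col : Vertex G → Vertex G → Fin k
    col-sym : ∀ u v → Adj G u v → col u v ≡ col v u
open EdgeColoring public

-- colour a is a conflict-free colour of the edge uv: exactly one edge of
-- E_G(uv) receives colour a
IsCFColorOf : {G : Graph} {k : ℕ} → EdgeColoring G k → Fin k → Vertex G → Vertex G → Set
IsCFColorOf {G} c a u v =
  Σ (Vertex G) λ x → Σ (Vertex G) λ y →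
    InClosedNbhd G u v x y × col c x y ≡ a ×
    (∀ x' y' → InClosedNbhd G u v x' y' → col c x' y' ≡ a → SameEdge x y x' y')

IsConflictFree : {G : Graph} {k : ℕ} → EdgeColoring G k → Set
IsConflictFree {G} {k} c = ∀ u v → Adj G u v → ∃ λ (a : Fin k) → IsCFColorOf c a u v

CFColorable : Graph → ℕ → Set
CFColorable G k = Σ (EdgeColoring G k) IsConflictFree

CFChromaticIndexIs : Graph → ℕ → Set
CFChromaticIndexIs G k = CFColorable G k × (∀ j → j < k → ¬ CFColorable G j)

record EdgeSet (G : Graph) : Set where
  field
    mem     : Vertex G → Vertex G → Bool
    mem-sym : ∀ u v → mem u v ≡ mem v u
    mem-adj : ∀ u v → mem u v ≡ true → Adj G u v
open EdgeSet public

In : {G : Graph} → EdgeSet G → Vertex G → Vertex G → Set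
In M u v = mem M u v ≡ true

IsMatching : {G : Graph} → EdgeSet G → Set
IsMatching {G} M = ∀ u v w → In M u v → In M u w → v ≡ w

IsMaximalMatching : {G : Graph} → EdgeSet G → Set
IsMaximalMatching {G} M =
  IsMatching M ×
  (∀ (M' : EdgeSet G) → IsMatching M' →
     (∀ u v → In M u v → In M' u v) → ∀ u v → In M' u v → In M u v)

Covered : {G : Graph} → EdgeSet G → Vertex G → Set
Covered {G} M v = Σ (Vertex G) λ w → In M v w

InducedIsM : {G : Graph} → EdgeSet G → Set
InducedIsM {G} M =
  ∀ u v → (Adj G u v × Covered M u × Covered M v → In M u v)
        × (In M u v → Adj G u v × Covered M u × Covered M v)

{-# OPTIONS --safe #-}
-- Given a conflict-free 2-edge-colouring, call an edge uniquely coloured if no edge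
-- adjacent to it has its colour. If uv is not uniquely coloured, its conflict-free colour
-- sits on an adjacent edge ut, and ut is uniquely coloured: otherwise the colour of uv
-- would be conflict-free for ut, and both colour classes at u would be single edges,
-- giving u degree 2. With two colours and no vertex of degree 2, no vertex lies on two
-- uniquely coloured edges, so these edges form a matching M meeting every edge; such a
-- matching is maximal, and V(M) induces exactly M. Conversely, for a maximal matching M
-- with T[V(M)] = M, colouring M by 1 and every other edge by 0 is conflict-free, since the
-- M-edge an edge meets is the only M-edge in its closed neighbourhood. One colour never
-- suffices: a connected graph on three vertices has two edges sharing a vertex, and each
-- lies in the closed neighbourhood of the other.
module Submission where

open import Defs
open import Data.Nat using (ℕ; _≤_; _<_; zero; suc; s≤s)
open import Data.Fin using (Fin; zero; suc)
open import Data.Fin.Properties using (_≟_; all?; any?; suc-injective; ¬Fin0)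
open import Data.Bool using (Bool; true; false)
open import Data.Bool.Properties using (¬-not) renaming (_≟_ to _≟ᵇ_)
open import Data.List using (length; filterᵇ; tabulate)
open import Data.Product using (Σ; ∃; _×_; _,_; proj₁)
open import Data.Sum using (_⊎_; inj₁; inj₂)
open import Function using (_∘_; id; case_of_)
open import Function.Bundles using (_⇔_; mk⇔)
open import Relation.Nullary using (¬_; Dec; yes; no; does; contradiction)
open import Relation.Nullary.Decidable using (dec-true; does-⇔; _×-dec_; _⊎-dec_; _→-dec_)
open import Relation.Binary.PropositionalEquality using (_≡_; _≢_; refl; trans; cong; subst)
import Relation.Binary.PropositionalEquality as ≡

does-true⇒ : ∀ {A : Set} (a? : Dec A) → does a? ≡ true → A
does-true⇒ (yes a) _ = a
does-true⇒ (no _) ()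

Fin2-pigeonhole : {a b c : Fin 2} → a ≢ c → b ≢ c → a ≡ b
Fin2-pigeonhole {zero}     {zero}     _   _   = refl
Fin2-pigeonhole {suc zero} {suc zero} _   _   = refl
Fin2-pigeonhole {zero}     {suc zero} {zero}     a≢c _   = contradiction refl a≢c
Fin2-pigeonhole {zero}     {suc zero} {suc zero} _   b≢c = contradiction refl b≢c
Fin2-pigeonhole {suc zero} {zero}     {zero}     _   b≢c = contradiction refl b≢c
Fin2-pigeonhole {suc zero} {zero}     {suc zero} a≢c _   = contradiction refl a≢c

Fin1-irrelevant : (i j : Fin 1) → i ≡ j
Fin1-irrelevant zero zero = refl

AtMostTwo : Set → Set
AtMostTwo A = (u v w : A) → v ≡ u ⊎ w ≡ u ⊎ v ≡ w

¬AtMostTwo-Fin : ∀ {k} → 3 ≤ k → ¬ AtMostTwo (Fin k)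
¬AtMostTwo-Fin {suc zero} (s≤s ())
¬AtMostTwo-Fin {suc (suc zero)} (s≤s (s≤s ()))
¬AtMostTwo-Fin {suc (suc (suc _))} _ two with two zero (suc zero) (suc (suc zero))
... | inj₁ ()
... | inj₂ (inj₁ ())
... | inj₂ (inj₂ ())

module _ {A : Set} (p : A → Bool) where

  length-filterᵇ-none : ∀ {k} (h : Fin k → A) → (∀ i → p (h i) ≡ false) →
                        length (filterᵇ p (tabulate h)) ≡ 0
  length-filterᵇ-none {zero}  h none = refl
  length-filterᵇ-none {suc k} h none rewrite none zero = length-filterᵇ-none (h ∘ suc) (none ∘ suc)

  length-filterᵇ-one : ∀ {k} (h : Fin k → A) (i : Fin k) → p (h i) ≡ true →
                       (∀ l → p (h l) ≡ true → l ≡ i) → length (filterᵇ p (tabulate h)) ≡ 1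
  length-filterᵇ-one {suc k} h zero hi only rewrite hi =
    cong suc (length-filterᵇ-none (h ∘ suc) λ l → ¬-not λ hl → case only (suc l) hl of λ ())
  length-filterᵇ-one {suc k} h (suc i) hi only
    rewrite ¬-not {p (h zero)} λ h0 → case only zero h0 of λ () =
    length-filterᵇ-one (h ∘ suc) i hi λ l hl → suc-injective (only (suc l) hl)

  length-filterᵇ-two : ∀ {k} (h : Fin k → A) (i j : Fin k) → i ≢ j → p (h i) ≡ true →
                       p (h j) ≡ true → (∀ l → p (h l) ≡ true → l ≡ i ⊎ l ≡ j) →
                       length (filterᵇ p (tabulate h)) ≡ 2
  length-filterᵇ-two h zero zero i≢j _ _ _ = contradiction refl i≢j
  length-filterᵇ-two {suc k} h zero (suc j) _ hi hj only rewrite hi =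
    cong suc (length-filterᵇ-one (h ∘ suc) j hj λ l hl → case only (suc l) hl of λ
      { (inj₁ ()) ; (inj₂ e) → suc-injective e })
  length-filterᵇ-two {suc k} h (suc i) zero _ hi hj only rewrite hj =
    cong suc (length-filterᵇ-one (h ∘ suc) i hi λ l hl → case only (suc l) hl of λ
      { (inj₁ e) → suc-injective e ; (inj₂ ()) })
  length-filterᵇ-two {suc k} h (suc i) (suc j) i≢j hi hj only
    rewrite ¬-not {p (h zero)} λ h0 → case only zero h0 of λ { (inj₁ ()) ; (inj₂ ()) } =
    length-filterᵇ-two (h ∘ suc) i j (i≢j ∘ cong suc) hi hj λ l hl → case only (suc l) hl of λ
      { (inj₁ e) → inj₁ (suc-injective e) ; (inj₂ e) → inj₂ (suc-injective e) }

module GraphProperties (G : Graph) where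

  adj? : ∀ u v → Dec (Adj G u v)
  adj? u v = adj G u v ≟ᵇ true

  Adj-sym : ∀ {u v} → Adj G u v → Adj G v u
  Adj-sym {u} {v} uv = trans (Graph.sym G v u) uv

  Adj-irrefl : ∀ {u v} → Adj G u v → u ≢ v
  Adj-irrefl {u} uu refl = case trans (≡.sym uu) (irrefl G u) of λ ()

  degree≡2 : ∀ {z t o} → t ≢ o → Adj G z t → Adj G z o →
             (∀ s → Adj G z s → s ≡ t ⊎ s ≡ o) → degree G z ≡ 2
  degree≡2 {z} {t} {o} = length-filterᵇ-two (adj G z) id t o

  InClosedNbhd-swap : ∀ {u v x y} → InClosedNbhd G u v x y → InClosedNbhd G v u x y
  InClosedNbhd-swap (xy , inj₁ x≡u)                 = xy , inj₂ (inj₁ x≡u)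
  InClosedNbhd-swap (xy , inj₂ (inj₁ x≡v))          = xy , inj₁ x≡v
  InClosedNbhd-swap (xy , inj₂ (inj₂ (inj₁ y≡u)))   = xy , inj₂ (inj₂ (inj₂ y≡u))
  InClosedNbhd-swap (xy , inj₂ (inj₂ (inj₂ y≡v)))   = xy , inj₂ (inj₂ (inj₁ y≡v))

module _ {A : Set} where

  SameEdge-sym : {x y p q : A} → SameEdge x y p q → SameEdge p q x y
  SameEdge-sym (inj₁ (refl , refl)) = inj₁ (refl , refl)
  SameEdge-sym (inj₂ (refl , refl)) = inj₂ (refl , refl)

  SameEdge-trans : {x y p q r s : A} → SameEdge x y p q → SameEdge p q r s → SameEdge x y r s
  SameEdge-trans (inj₁ (refl , refl)) e                    = e
  SameEdge-trans (inj₂ (refl , refl)) (inj₁ (refl , refl)) = inj₂ (refl , refl)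
  SameEdge-trans (inj₂ (refl , refl)) (inj₂ (refl , refl)) = inj₁ (refl , refl)

  SameEdge-functional : {x y p q r : A} → x ≢ y → SameEdge x y p q → SameEdge x y p r → q ≡ r
  SameEdge-functional _   (inj₁ (refl , refl)) (inj₁ (_ , refl))   = refl
  SameEdge-functional x≢y (inj₁ (refl , refl)) (inj₂ (x≡y , _))    = contradiction x≡y x≢y
  SameEdge-functional x≢y (inj₂ (refl , refl)) (inj₁ (y≡x , _))    = contradiction (≡.sym y≡x) x≢y
  SameEdge-functional _   (inj₂ (refl , refl)) (inj₂ (_ , refl))   = refl

module DecidableEdgeSet (G : Graph) {R : Vertex G → Vertex G → Set}
  (R? : ∀ u v → Dec (R u v)) (R-sym : ∀ {u v} → R u v → R v u)
  (R⇒Adj : ∀ {u v} → R u v → Adj G u v) where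

  edgeSet : EdgeSet G
  edgeSet = record
    { mem     = λ u v → does (R? u v)
    ; mem-sym = λ u v → does-⇔ (mk⇔ R-sym R-sym) (R? u v) (R? v u)
    ; mem-adj = λ u v → R⇒Adj ∘ does-true⇒ (R? u v)
    }

  In⁺ : ∀ {u v} → R u v → In edgeSet u v
  In⁺ {u} {v} = dec-true (R? u v)

  In⁻ : ∀ {u v} → In edgeSet u v → R u v
  In⁻ {u} {v} = does-true⇒ (R? u v)

module _ {G : Graph} where
  open GraphProperties G

  In-sym : (M : EdgeSet G) → ∀ {u v} → In M u v → In M v u
  In-sym M {u} {v} uv = trans (mem-sym M v u) uv

  covered? : (M : EdgeSet G) → ∀ u → Dec (Covered M u)
  covered? M u = any? λ w → mem M u w ≟ᵇ true

  CoversEdges : EdgeSet G → Set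
  CoversEdges M = ∀ u v → Adj G u v → Covered M u ⊎ Covered M v

  InducedIsM-intro : {M : EdgeSet G} →
                     (∀ {u v} → Adj G u v → Covered M u → Covered M v → In M u v) → InducedIsM M
  InducedIsM-intro {M} covered⇒In u v =
    (λ (uv , cu , cv) → covered⇒In uv cu cv) ,
    (λ m → mem-adj M u v m , (v , m) , (u , In-sym M m))

  matching-SameEdge : {M : EdgeSet G} → IsMatching M → ∀ {x y x′ y′} → In M x y →
                      InClosedNbhd G x y x′ y′ → In M x′ y′ → SameEdge x y x′ y′
  matching-SameEdge {M} matching {x} {y} {x′} {y′} xy (_ , inj₁ refl) xy′ =
    inj₁ (refl , ≡.sym (matching x y y′ xy xy′))
  matching-SameEdge {M} matching {x} {y} {x′} {y′} xy (_ , inj₂ (inj₁ refl)) xy′ =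
    inj₂ (refl , ≡.sym (matching y x y′ (In-sym M xy) xy′))
  matching-SameEdge {M} matching {x} {y} {x′} {y′} xy (_ , inj₂ (inj₂ (inj₁ refl))) xy′ =
    inj₂ (≡.sym (matching x y x′ xy (In-sym M xy′)) , refl)
  matching-SameEdge {M} matching {x} {y} {x′} {y′} xy (_ , inj₂ (inj₂ (inj₂ refl))) xy′ =
    inj₁ (≡.sym (matching y x x′ (In-sym M xy) (In-sym M xy′)) , refl)

  module AddEdge (M : EdgeSet G) (matching : IsMatching M) {u v : Vertex G} (uv : Adj G u v)
                 (u-free : ¬ Covered M u) (v-free : ¬ Covered M v) where

    InM+uv : Vertex G → Vertex G → Set
    InM+uv x y = In M x y ⊎ SameEdge u v x y

    free : ∀ {x y} → SameEdge u v x y → ¬ Covered M x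
    free (inj₁ (refl , _)) = u-free
    free (inj₂ (refl , _)) = v-free

    InM+uv? : ∀ x y → Dec (InM+uv x y)
    InM+uv? x y = (mem M x y ≟ᵇ true) ⊎-dec ((x ≟ u ×-dec y ≟ v) ⊎-dec (x ≟ v ×-dec y ≟ u))

    InM+uv-sym : ∀ {x y} → InM+uv x y → InM+uv y x
    InM+uv-sym (inj₁ xy) = inj₁ (In-sym M xy)
    InM+uv-sym (inj₂ e)  = inj₂ (SameEdge-trans e (inj₂ (refl , refl)))

    InM+uv⇒Adj : ∀ {x y} → InM+uv x y → Adj G x y
    InM+uv⇒Adj {x} {y} (inj₁ xy)           = mem-adj M x y xy
    InM+uv⇒Adj (inj₂ (inj₁ (refl , refl))) = uv
    InM+uv⇒Adj (inj₂ (inj₂ (refl , refl))) = Adj-sym uv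

    open DecidableEdgeSet G InM+uv? InM+uv-sym InM+uv⇒Adj public renaming (edgeSet to M+uv)

    M+uv-matching : IsMatching M+uv
    M+uv-matching x y z xy xz with In⁻ xy | In⁻ xz
    ... | inj₁ xy∈M | inj₁ xz∈M = matching x y z xy∈M xz∈M
    ... | inj₁ xy∈M | inj₂ e    = contradiction (y , xy∈M) (free e)
    ... | inj₂ e    | inj₁ xz∈M = contradiction (z , xz∈M) (free e)
    ... | inj₂ e    | inj₂ e′   = SameEdge-functional (Adj-irrefl uv) e e′

  maximal⇒covers : {M : EdgeSet G} → IsMaximalMatching M → CoversEdges M
  maximal⇒covers {M} (matching , maximal) u v uv with covered? M u | covered? M v
  ... | yes cu | _      = inj₁ cu
  ... | no _   | yes cv = inj₂ cv
  ... | no ¬cu | no ¬cv = contradiction (v , maximal M+uv M+uv-matching (λ _ _ → In⁺ ∘ inj₁) u v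
                                               (In⁺ (inj₂ (inj₁ (refl , refl))))) ¬cu
    where open AddEdge M matching uv ¬cu ¬cv

  covers⇒maximal : {M : EdgeSet G} → IsMatching M → CoversEdges M → IsMaximalMatching M
  covers⇒maximal {M} matching covers = matching , maximal
    where
    maximal : ∀ (M′ : EdgeSet G) → IsMatching M′ →
              (∀ u v → In M u v → In M′ u v) → ∀ u v → In M′ u v → In M u v
    maximal M′ matching′ M⊆M′ u v uv with covers u v (mem-adj M′ u v uv)
    ... | inj₁ (t , ut) = subst (In M u) (matching′ u t v (M⊆M′ u t ut) uv) ut
    ... | inj₂ (t , vt) =
      In-sym M (subst (In M v) (matching′ v t u (M⊆M′ v t vt) (In-sym M′ uv)) vt)

module _ {G : Graph} {k : ℕ} (c : EdgeColoring G k) where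
  open GraphProperties G

  IsCFColorOf-swap : ∀ {a u v} → IsCFColorOf c a u v → IsCFColorOf c a v u
  IsCFColorOf-swap (x , y , nb , xy≡a , only) =
    x , y , InClosedNbhd-swap nb , xy≡a , λ x′ y′ → only x′ y′ ∘ InClosedNbhd-swap

  cfColour-unique : ∀ {a u v x y x′ y′} → IsCFColorOf c a u v →
                    InClosedNbhd G u v x y → col c x y ≡ a →
                    InClosedNbhd G u v x′ y′ → col c x′ y′ ≡ a → SameEdge x y x′ y′
  cfColour-unique (_ , _ , _ , _ , only) nb xy≡a nb′ xy′≡a =
    SameEdge-trans (SameEdge-sym (only _ _ nb xy≡a)) (only _ _ nb′ xy′≡a)

  cfColour-unique-at : ∀ {a u v t s r} → IsCFColorOf c a u v →
                       InClosedNbhd G u v t s → col c t s ≡ a →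
                       InClosedNbhd G u v t r → col c t r ≡ a → s ≡ r
  cfColour-unique-at cf nb ts≡a nb′ tr≡a =
    SameEdge-functional (Adj-irrefl (proj₁ nb)) (inj₁ (refl , refl))
      (cfColour-unique cf nb ts≡a nb′ tr≡a)

  Solitary : Vertex G → Vertex G → Set
  Solitary u v = ∀ s → Adj G u s → col c u s ≡ col c u v → s ≡ v

  UniquelyColoured : Vertex G → Vertex G → Set
  UniquelyColoured u v = Adj G u v × Solitary u v × Solitary v u

  BorrowsCF : Vertex G → Vertex G → Vertex G → Set
  BorrowsCF u v t = Adj G u t × col c u t ≢ col c u v × IsCFColorOf c (col c u t) u v

  ownCF⇒uniquelyColoured : ∀ {u v} → Adj G u v → IsCFColorOf c (col c u v) u v →
                           UniquelyColoured u v
  ownCF⇒uniquelyColoured {u} {v} uv cf = uv , at-u , at-v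
    where
    vu≡uv : col c v u ≡ col c u v
    vu≡uv = col-sym c v u (Adj-sym uv)
    at-u : Solitary u v
    at-u s us same = cfColour-unique-at cf (us , inj₁ refl) same (uv , inj₁ refl) refl
    at-v : Solitary v u
    at-v s vs same = cfColour-unique-at cf (vs , inj₂ (inj₁ refl)) (trans same vu≡uv)
                                           (Adj-sym uv , inj₂ (inj₁ refl)) vu≡uv

  borrowsCF-intro : ∀ {a u v t} → IsCFColorOf c a u v → Adj G u t → col c u t ≡ a →
                    col c u v ≢ a → BorrowsCF u v t
  borrowsCF-intro {u = u} {v} cf ut ut≡a uv≢a =
    ut , (λ e → uv≢a (trans (≡.sym e) ut≡a)) , subst (λ b → IsCFColorOf c b u v) (≡.sym ut≡a) cf

  uniquelyColoured? : ∀ u v → Dec (UniquelyColoured u v)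
  uniquelyColoured? u v = adj? u v ×-dec solitary? u v ×-dec solitary? v u
    where
    solitary? : ∀ u v → Dec (Solitary u v)
    solitary? u v = all? λ s → adj? u s →-dec (col c u s ≟ col c u v →-dec s ≟ v)

  uniquelyColoured-sym : ∀ {u v} → UniquelyColoured u v → UniquelyColoured v u
  uniquelyColoured-sym (uv , at-u , at-v) = Adj-sym uv , at-v , at-u

  open DecidableEdgeSet G uniquelyColoured? uniquelyColoured-sym proj₁ public
    renaming (edgeSet to uniquelyColouredEdges; In⁺ to uniquelyColoured⇒In; In⁻ to In⇒uniquelyColoured)

  uniquelyColoured-or-borrows : IsConflictFree c → ∀ {u v} → Adj G u v →
    UniquelyColoured u v ⊎ ∃ (BorrowsCF u v) ⊎ ∃ (BorrowsCF v u)
  uniquelyColoured-or-borrows cf {u} {v} uv with cf u v uv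
  ... | a , cfa@(x , y , (xy , touches) , xy≡a , _) with col c u v ≟ a | touches
  ...   | yes refl | _ = inj₁ (ownCF⇒uniquelyColoured uv cfa)
  ...   | no uv≢a | inj₁ refl =
    inj₂ (inj₁ (y , borrowsCF-intro cfa xy xy≡a uv≢a))
  ...   | no uv≢a | inj₂ (inj₁ refl) =
    inj₂ (inj₂ (y , borrowsCF-intro (IsCFColorOf-swap cfa) xy xy≡a (uv≢a ∘ trans (col-sym c u v uv))))
  ...   | no uv≢a | inj₂ (inj₂ (inj₁ refl)) =
    inj₂ (inj₁ (x , borrowsCF-intro cfa (Adj-sym xy) (trans (col-sym c u x (Adj-sym xy)) xy≡a) uv≢a))
  ...   | no uv≢a | inj₂ (inj₂ (inj₂ refl)) =
    inj₂ (inj₂ (x , borrowsCF-intro (IsCFColorOf-swap cfa) (Adj-sym xy)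
                      (trans (col-sym c v x (Adj-sym xy)) xy≡a) (uv≢a ∘ trans (col-sym c u v uv))))

module _ {G : Graph} {c : EdgeColoring G 2} where
  open GraphProperties G

  solitary-pair⇒degree≡2 : ∀ {u v w} → Adj G u v → Adj G u w → col c u v ≢ col c u w →
                           Solitary c u v → Solitary c u w → degree G u ≡ 2
  solitary-pair⇒degree≡2 {u} {v} {w} uv uw uv≢uw at-v at-w =
    degree≡2 (λ { refl → uv≢uw refl }) uv uw neighbours
    where
    neighbours : ∀ s → Adj G u s → s ≡ v ⊎ s ≡ w
    neighbours s us with col c u s ≟ col c u v
    ... | yes us≡uv = inj₁ (at-v s us us≡uv)
    ... | no us≢uv  = inj₂ (at-w s us (Fin2-pigeonhole us≢uv (uv≢uw ∘ ≡.sym)))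

  module _ (cf : IsConflictFree c) (no-deg2 : ∀ v → degree G v ≢ 2) where

    uniquelyColoured-matching : ∀ u v w → UniquelyColoured c u v → UniquelyColoured c u w → v ≡ w
    uniquelyColoured-matching u v w (uv , at-v , _) (uw , at-w , _) with col c u v ≟ col c u w
    ... | yes uv≡uw = ≡.sym (at-v w uw (≡.sym uv≡uw))
    ... | no uv≢uw  = contradiction (solitary-pair⇒degree≡2 uv uw uv≢uw at-v at-w) (no-deg2 u)

    borrowsCF⇒uniquelyColoured : ∀ {u v t} → Adj G u v → BorrowsCF c u v t → UniquelyColoured c u t
    borrowsCF⇒uniquelyColoured {u} {v} {t} uv (ut , ut≢uv , cf-uv) = ut , at-u , at-t
      where
      at-u : Solitary c u t
      at-u s us same = cfColour-unique-at c cf-uv (us , inj₁ refl) same (ut , inj₁ refl) refl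
      at-t : Solitary c t u
      at-t s ts same with cf u t ut
      ... | a , cf-ut with col c u t ≟ a
      ...   | yes ut≡a = cfColour-unique-at c cf-ut (ts , inj₂ (inj₁ refl)) (trans same tu≡a)
                                                    (Adj-sym ut , inj₂ (inj₁ refl)) tu≡a
        where
        tu≡a : col c t u ≡ a
        tu≡a = trans (col-sym c t u (Adj-sym ut)) ut≡a
      ...   | no ut≢a = contradiction (solitary-pair⇒degree≡2 ut uv ut≢uv at-u at-v) (no-deg2 u)
        where
        uv≡a : col c u v ≡ a
        uv≡a = Fin2-pigeonhole (ut≢uv ∘ ≡.sym) (ut≢a ∘ ≡.sym)
        at-v : Solitary c u v
        at-v s us same′ = cfColour-unique-at c cf-ut (us , inj₁ refl) (trans same′ uv≡a)
                                                     (uv , inj₁ refl) uv≡a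

    borrowsCF⇒partner : ∀ {u v t r} → Adj G u v → BorrowsCF c u v t →
                        Adj G v r → Solitary c v r → r ≡ u
    borrowsCF⇒partner {u} {v} {t} {r} uv (ut , ut≢uv , cf-uv) vr at-r with col c v r ≟ col c u t
    ... | yes vr≡ut with cfColour-unique c cf-uv (ut , inj₁ refl) refl (vr , inj₂ (inj₁ refl)) vr≡ut
    ...   | inj₁ (v≡u , _) = contradiction (≡.sym v≡u) (Adj-irrefl uv)
    ...   | inj₂ (_ , r≡u) = r≡u
    borrowsCF⇒partner {u} {v} {t} {r} uv (ut , ut≢uv , cf-uv) vr at-r | no vr≢ut =
      ≡.sym (at-r u (Adj-sym uv) (trans (col-sym c v u (Adj-sym uv)) (≡.sym vr≡uv)))
      where
      vr≡uv : col c v r ≡ col c u v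
      vr≡uv = Fin2-pigeonhole vr≢ut (ut≢uv ∘ ≡.sym)

    private
      M : EdgeSet G
      M = uniquelyColouredEdges c

    uniquelyColouredEdges-matching : IsMatching M
    uniquelyColouredEdges-matching u v w uv uw =
      uniquelyColoured-matching u v w (In⇒uniquelyColoured c uv) (In⇒uniquelyColoured c uw)

    uniquelyColouredEdges-covers : CoversEdges M
    uniquelyColouredEdges-covers u v uv with uniquelyColoured-or-borrows c cf uv
    ... | inj₁ uv-unique     = inj₁ (v , uniquelyColoured⇒In c uv-unique)
    ... | inj₂ (inj₁ (t , b)) = inj₁ (t , uniquelyColoured⇒In c (borrowsCF⇒uniquelyColoured uv b))
    ... | inj₂ (inj₂ (t , b)) = inj₂ (t , uniquelyColoured⇒In c (borrowsCF⇒uniquelyColoured (Adj-sym uv) b))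

    uniquelyColouredEdges-induced : InducedIsM M
    uniquelyColouredEdges-induced = InducedIsM-intro {M = M} covered⇒In
      where
      covered⇒In : ∀ {u v} → Adj G u v → Covered M u → Covered M v → In M u v
      covered⇒In {u} {v} uv (r , ur) (r′ , vr′) with uniquelyColoured-or-borrows c cf uv
      ... | inj₁ uv-unique = uniquelyColoured⇒In c uv-unique
      ... | inj₂ (inj₁ (_ , b)) =
        let (vr′-edge , at-r′ , _) = In⇒uniquelyColoured c vr′
        in In-sym M (subst (In M v) (borrowsCF⇒partner uv b vr′-edge at-r′) vr′)
      ... | inj₂ (inj₂ (_ , b)) =
        let (ur-edge , at-r , _) = In⇒uniquelyColoured c ur
        in subst (In M u) (borrowsCF⇒partner (Adj-sym uv) b ur-edge at-r) ur

    cf2⇒inducedMaximalMatching : Σ (EdgeSet G) (λ M → IsMaximalMatching M × InducedIsM M)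
    cf2⇒inducedMaximalMatching =
      M , covers⇒maximal {M = M} uniquelyColouredEdges-matching uniquelyColouredEdges-covers ,
      uniquelyColouredEdges-induced

bit : Bool → Fin 2
bit false = zero
bit true  = suc zero

bit-injective : ∀ {a b} → bit a ≡ bit b → a ≡ b
bit-injective {false} {false} _ = refl
bit-injective {true}  {true}  _ = refl

module _ {G : Graph} where
  open GraphProperties G

  matchingColouring : EdgeSet G → EdgeColoring G 2
  matchingColouring M = record
    { col     = λ u v → bit (mem M u v)
    ; col-sym = λ u v _ → cong bit (mem-sym M u v)
    }

  module _ {M : EdgeSet G} (matching : IsMatching M) (induced : InducedIsM M) where

    -- Whichever endpoint of an M-edge in E(uv) lies on uv, it lies on uw as well:
    -- if it is v, then u and v are both covered, so uv ∈ M and v = w.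
    matchingColouring-cf-at : ∀ {u v w} → Adj G u v → In M u w →
                              IsCFColorOf (matchingColouring M) (bit true) u v
    matchingColouring-cf-at {u} {v} {w} uv uw =
      u , w , (mem-adj M u w uw , inj₁ refl) , cong bit uw ,
      λ x y nb xy≡1 → let xy∈M = bit-injective xy≡1 in
        matching-SameEdge {M = M} matching uw (within-uw nb xy∈M) xy∈M
      where
      v≡w : Covered M v → v ≡ w
      v≡w cv = matching u v w (proj₁ (induced u v) (uv , (w , uw) , cv)) uw
      within-uw : ∀ {x y} → InClosedNbhd G u v x y → In M x y → InClosedNbhd G u w x y
      within-uw (xy , inj₁ x≡u)                 _    = xy , inj₁ x≡u
      within-uw (xy , inj₂ (inj₁ refl))         xy∈M = xy , inj₂ (inj₁ (v≡w (_ , xy∈M)))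
      within-uw (xy , inj₂ (inj₂ (inj₁ y≡u)))   _    = xy , inj₂ (inj₂ (inj₁ y≡u))
      within-uw (xy , inj₂ (inj₂ (inj₂ refl)))  xy∈M = xy , inj₂ (inj₂ (inj₂ (v≡w (_ , In-sym M xy∈M))))

  matchingColouring-conflictFree : {M : EdgeSet G} → IsMaximalMatching M → InducedIsM M →
                                   IsConflictFree (matchingColouring M)
  matchingColouring-conflictFree {M} maximal induced u v uv with maximal⇒covers {M = M} maximal u v uv
  ... | inj₁ (_ , uw) = bit true , matchingColouring-cf-at {M = M} (proj₁ maximal) induced uv uw
  ... | inj₂ (_ , vw) = bit true , IsCFColorOf-swap (matchingColouring M)
                          (matchingColouring-cf-at {M = M} (proj₁ maximal) induced (Adj-sym uv) vw)

P3Free : Graph → Set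
P3Free G = ∀ {a b d} → Adj G a b → Adj G b d → a ≡ d

module _ {G : Graph} where
  open GraphProperties G

  cf1⇒P3Free : (c : EdgeColoring G 1) → IsConflictFree c → P3Free G
  cf1⇒P3Free c cf {a} {b} {d} ab bd with cf a b ab
  ... | _ , cf-ab with cfColour-unique c cf-ab (ab , inj₁ refl) (Fin1-irrelevant _ _)
                                               (bd , inj₂ (inj₁ refl)) (Fin1-irrelevant _ _)
  ...   | inj₁ (b≡a , _) = contradiction (≡.sym b≡a) (Adj-irrefl ab)
  ...   | inj₂ (_ , d≡a) = ≡.sym d≡a

  P3Free⇒walk-short : P3Free G → ∀ {u w} → Walk G u w → w ≡ u ⊎ Adj G u w
  P3Free⇒walk-short p3 nil = inj₁ refl
  P3Free⇒walk-short p3 (cons uv vw) with P3Free⇒walk-short p3 vw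
  ... | inj₁ refl = inj₂ uv
  ... | inj₂ vw′  = inj₁ (≡.sym (p3 uv vw′))

  connected-P3Free⇒atMostTwo : Connected G → P3Free G → AtMostTwo (Vertex G)
  connected-P3Free⇒atMostTwo conn p3 u v w
    with P3Free⇒walk-short p3 (conn u v) | P3Free⇒walk-short p3 (conn u w)
  ... | inj₁ v≡u | _        = inj₁ v≡u
  ... | inj₂ _   | inj₁ w≡u = inj₂ (inj₁ w≡u)
  ... | inj₂ uv  | inj₂ uw  = inj₂ (inj₂ (p3 (Adj-sym uv) uw))

  ¬CFColorable-<2 : Connected G → ¬ AtMostTwo (Vertex G) → ∀ j → j < 2 → ¬ CFColorable G j
  ¬CFColorable-<2 _    many zero          _ (c , _)  = many λ u _ _ → contradiction (col c u u) ¬Fin0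
  ¬CFColorable-<2 conn many (suc zero)    _ (c , cf) =
    many (connected-P3Free⇒atMostTwo conn (cf1⇒P3Free c cf))
  ¬CFColorable-<2 _    _    (suc (suc _)) (s≤s (s≤s ()))

theorem2 : (T : Graph) → IsTree T → 3 ≤ n T → (∀ v → ¬ (degree T v ≡ 2)) →
    CFChromaticIndexIs T 2 ⇔ Σ (EdgeSet T) (λ M → IsMaximalMatching M × InducedIsM M)
theorem2 T (connected , _) 3≤n no-deg2 = mk⇔
  (λ ((c , cf) , _) → cf2⇒inducedMaximalMatching {c = c} cf no-deg2)
  (λ (M , maximal , induced) →
    (matchingColouring M , matchingColouring-conflictFree {M = M} maximal induced) ,
    ¬CFColorable-<2 connected (¬AtMostTwo-Fin 3≤n))
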